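{- Let $f\colon\{0,1\}^n\to\{ -1,1\}$. Then for $d=0,1,\dots,n$, \[ \frac{1}{1-E(f,d)}\le W(f,d)\le\frac{2}{1-E(f,d)}\left\{\binom n0+\binom n1+\cdots+\binom nd\right\}^{3/2}, \] with the convention $1/0=\infty$.
   Context: $E(f,d)=\min_p\max_{x\in\{0,1\}^n}|f(x)-p(x)|$, the minimum over real polynomials $p$ of degree at most $d$. For $S\subseteq[n]$, $\chi_S(x)=(-1)^{\sum_{i\in S}x_i}$. The degree-$d$ threshold weight $W(f,d)$ is the minimum of $\sum_{|S|\le d}|\lambda_S|$ over all integers $\lambda_S$ ($S\subseteq[n]$, $|S|\le d$) such that $f(x)=\mathrm{sign}\left(\sum_{|S|\le d}\lambda_S\chi_S(x)\right)$ for all $x\in\{0,1\}^n$; if no such integers exist, $W(f,d)=\infty$.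
   Formalization: The polynomials of degree at most d in the definition of E(f,d) have rational coefficients rather than real ones, so E(f,d) is taken in ℚ. -}

module Defs where

open import Data.Bool using (Bool; true; false; if_then_else_; _∧_)
open import Data.Nat as ℕ using (ℕ; zero; suc; _≤?_)
open import Data.Nat.Combinatorics using (_C_)
open import Data.Integer as ℤ using (ℤ; +_; -[1+_])
open import Data.Rational as ℚ using (ℚ; 0ℚ; 1ℚ; _/_)
open import Data.Vec using (Vec; []; _∷_)
open import Data.List using (List; []; _∷_; map; filter; foldr; _++_)
open import Data.Fin.Subset using (Subset; ∣_∣)
open import Data.Product using (Σ; _×_)
open import Relation.Binary.PropositionalEquality using (_≡_)
open import Relation.Nullary using (¬_)

-- All vectors in {0,1}^n (true = 1).  Also used to enumerate all subsets S ⊆ [n]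
-- (Subset n = Vec Bool n, true = inside).
cube : (n : ℕ) → List (Vec Bool n)
cube zero    = [] ∷ []
cube (suc n) = map (true ∷_) (cube n) ++ map (false ∷_) (cube n)

lowSubsets : (n d : ℕ) → List (Subset n)
lowSubsets n d = filter (λ S → ∣ S ∣ ≤? d) (cube n)

sumℚ : List ℚ → ℚ
sumℚ = foldr ℚ._+_ 0ℚ

sumℤ : List ℤ → ℤ
sumℤ = foldr ℤ._+_ (+ 0)

sumℕ : List ℕ → ℕ
sumℕ = foldr ℕ._+_ 0

monomial : ∀ {n} → Subset n → Vec Bool n → ℚ
monomial []      []      = 1ℚ
monomial (s ∷ S) (b ∷ x) = (if s then (if b then 1ℚ else 0ℚ) else 1ℚ) ℚ.* monomial S x

χ : ∀ {n} → Subset n → Vec Bool n → ℤ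
χ []      []      = + 1
χ (s ∷ S) (b ∷ x) = (if s ∧ b then -[1+ 0 ] else + 1) ℤ.* χ S x

-- A real (here: rational) polynomial of degree ≤ d on {0,1}^n, given by its
-- coefficients c_S on the multilinear monomials ∏_{i∈S} x_i with |S| ≤ d.
evalPoly : (n d : ℕ) → (Subset n → ℚ) → Vec Bool n → ℚ
evalPoly n d c x = sumℚ (map (λ S → c S ℚ.* monomial S x) (lowSubsets n d))

toℚ : ℤ → ℚ
toℚ z = z / 1

approxErr : (n d : ℕ) → (Vec Bool n → ℤ) → (Subset n → ℚ) → ℚ
approxErr n d f c = foldr ℚ._⊔_ 0ℚ (map (λ x → ℚ.∣ toℚ (f x) ℚ.- evalPoly n d c x ∣) (cube n))

IsE : (n : ℕ) → (Vec Bool n → ℤ) → ℕ → ℚ → Set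
IsE n f d e = Σ (Subset n → ℚ) (λ c → approxErr n d f c ≡ e)
            × (∀ (c : Subset n → ℚ) → e ℚ.≤ approxErr n d f c)

sgn : ℤ → ℤ
sgn (+ zero)  = + 0
sgn (+ suc _) = + 1
sgn -[1+ _ ]  = -[1+ 0 ]

Represents : (n d : ℕ) → (Vec Bool n → ℤ) → (Subset n → ℤ) → Set
Represents n d f λ′ = ∀ (x : Vec Bool n) →
  f x ≡ sgn (sumℤ (map (λ S → λ′ S ℤ.* χ S x) (lowSubsets n d)))

weight : (n d : ℕ) → (Subset n → ℤ) → ℕ
weight n d λ′ = sumℕ (map (λ S → ℤ.∣ λ′ S ∣) (lowSubsets n d))

IsW : (n : ℕ) → (Vec Bool n → ℤ) → ℕ → ℕ → Set
IsW n f d w = Σ (Subset n → ℤ) (λ λ′ → Represents n d f λ′ × weight n d λ′ ≡ w)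
            × (∀ (λ′ : Subset n → ℤ) → Represents n d f λ′ → w ℕ.≤ weight n d λ′)

WInfinite : (n : ℕ) → (Vec Bool n → ℤ) → ℕ → Set
WInfinite n f d = ∀ (λ′ : Subset n → ℤ) → ¬ Represents n d f λ′

binomSum : ℕ → ℕ → ℕ
binomSum n zero    = n C 0
binomSum n (suc d) = binomSum n d ℕ.+ n C suc d

ℕtoℚ : ℕ → ℚ
ℕtoℚ k = (+ k) / 1

-- Lower bound: if f = sgn P with P = Σ_{|S|≤d} λ_S χ_S integral of weight W, then
-- 1 ≤ f·P ≤ W pointwise, so the degree-d polynomial P/W is within 1 - 1/W of f.
-- Upper bound: let p be a best approximation and δ = 1 - E > 0, so f·p ≥ δ and |p| ≤ 2.
-- By Parseval the character coefficients a_S of p satisfy Σ a_S² ≤ 4, hence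
-- (Σ |a_S|)² ≤ 4L by Cauchy–Schwarz, where L = C(n,0) + … + C(n,d) counts them.
-- Rounding K a_S toward zero, K = L/δ, moves K p by less than L = Kδ ≤ K f p, so the
-- rounded integers still represent f, with weight at most K Σ |a_S|; squaring gives
-- (W δ)² ≤ 4L³.  For E < 1 this also shows W < ∞, while E ≤ 1 via the zero polynomial.

{-# OPTIONS --safe #-}
module Submission where

open import Defs
open import Level using (0ℓ)
open import Function using (_∘_)
open import Data.Bool using (Bool; true; false; if_then_else_)
open import Data.Nat as ℕ using (ℕ; zero; suc; _≤?_) renaming (_≤_ to _≤ℕ_)
import Data.Nat.Properties as ℕₚ
import Algebra.Properties.CommutativeSemigroup ℕₚ.+-commutativeSemigroup as ℕ+
open import Data.Nat.Combinatorics using (_C_; nCk+nC[k+1]≡[n+1]C[k+1])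
open import Data.Integer as ℤ using (ℤ; +_; -[1+_])
import Data.Integer.Properties as ℤₚ
open import Data.Integer.DivMod using (_/ℕ_; [n/ℕd]*d≤n; n<s[n/ℕd]*d; 0≤n⇒0≤n/ℕd)
open import Data.Rational as ℚ using (ℚ; mkℚ; 0ℚ; 1ℚ; _+_; _*_; _-_; -_; _≤_; _<_; _⊔_; ∣_∣; 1/_; toℚᵘ; nonNegative; positive)
open import Data.Rational.Properties hiding (_≤?_)
import Data.Rational.Unnormalised as ℚᵘ
import Data.Rational.Unnormalised.Properties as ℚᵘₚ
open import Data.List using (List; []; _∷_; map; filter; foldr; _++_; length)
open import Data.List.Properties using (filter-++; length-++; length-map)
open import Data.List.Membership.Propositional using (_∈_)
open import Data.List.Membership.Propositional.Properties using (∈-++⁺ˡ; ∈-++⁺ʳ; ∈-map⁺)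
open import Data.List.Relation.Unary.Any using (here; there)
open import Data.Vec using (Vec; []; _∷_; replicate)
open import Data.Fin.Subset using (Subset) renaming (∣_∣ to ∣_∣ˢ)
open import Data.Nat.Coprimality using (Coprime)
open import Data.Product using (∃; _×_; _,_; proj₁; proj₂)
open import Data.Sum using (_⊎_; inj₁; inj₂)
open import Data.Empty using (⊥-elim)
open import Relation.Nullary using (Dec; yes; no; does)
open import Relation.Nullary.Decidable using (dec⇒maybe; dec-false)
open import Relation.Unary using (Pred; Decidable)
open import Relation.Binary.PropositionalEquality
open import Tactic.RingSolver using (solve-∀)
open import Tactic.RingSolver.Core.AlmostCommutativeRing using (AlmostCommutativeRing; fromCommutativeRing)

ℚ-ring : AlmostCommutativeRing 0ℓ 0ℓ
ℚ-ring = fromCommutativeRing +-*-commutativeRing (λ q → dec⇒maybe (0ℚ ≟ q))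

-- Integers and signs inside ℚ

fromℤᵘ : ℤ → ℚᵘ.ℚᵘ
fromℤᵘ z = ℚᵘ.mkℚᵘ z 0

toℚᵘ-toℚ : ∀ z → toℚᵘ (toℚ z) ℚᵘ.≃ fromℤᵘ z
toℚᵘ-toℚ z = toℚᵘ-fromℚᵘ (fromℤᵘ z)

toℚ-+ : ∀ a b → toℚ (a ℤ.+ b) ≡ toℚ a + toℚ b
toℚ-+ a b = toℚᵘ-injective (begin
  toℚᵘ (toℚ (a ℤ.+ b))             ≈⟨ toℚᵘ-toℚ (a ℤ.+ b) ⟩
  fromℤᵘ (a ℤ.+ b)                  ≈⟨ ℚᵘ.*≡* (cong (ℤ._* + 1) (cong₂ ℤ._+_ (sym (ℤₚ.*-identityʳ a)) (sym (ℤₚ.*-identityʳ b)))) ⟩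
  fromℤᵘ a ℚᵘ.+ fromℤᵘ b            ≈⟨ ℚᵘₚ.+-cong (toℚᵘ-toℚ a) (toℚᵘ-toℚ b) ⟨
  toℚᵘ (toℚ a) ℚᵘ.+ toℚᵘ (toℚ b)    ≈⟨ toℚᵘ-homo-+ (toℚ a) (toℚ b) ⟨
  toℚᵘ (toℚ a + toℚ b)             ∎)
  where open ℚᵘₚ.≃-Reasoning

toℚ-* : ∀ a b → toℚ (a ℤ.* b) ≡ toℚ a * toℚ b
toℚ-* a b = toℚᵘ-injective (begin
  toℚᵘ (toℚ (a ℤ.* b))             ≈⟨ toℚᵘ-toℚ (a ℤ.* b) ⟩
  fromℤᵘ a ℚᵘ.* fromℤᵘ b            ≈⟨ ℚᵘₚ.*-cong (toℚᵘ-toℚ a) (toℚᵘ-toℚ b) ⟨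
  toℚᵘ (toℚ a) ℚᵘ.* toℚᵘ (toℚ b)    ≈⟨ toℚᵘ-homo-* (toℚ a) (toℚ b) ⟨
  toℚᵘ (toℚ a * toℚ b)             ∎)
  where open ℚᵘₚ.≃-Reasoning

toℚ-neg : ∀ a → toℚ (ℤ.- a) ≡ - toℚ a
toℚ-neg a = toℚᵘ-injective (begin
  toℚᵘ (toℚ (ℤ.- a))    ≈⟨ toℚᵘ-toℚ (ℤ.- a) ⟩
  ℚᵘ.- fromℤᵘ a         ≈⟨ ℚᵘₚ.-‿cong (toℚᵘ-toℚ a) ⟨
  ℚᵘ.- toℚᵘ (toℚ a)     ≈⟨ toℚᵘ-homo‿- (toℚ a) ⟨
  toℚᵘ (- toℚ a)        ∎)
  where open ℚᵘₚ.≃-Reasoning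

∣toℚ∣ : ∀ a → ∣ toℚ a ∣ ≡ ℕtoℚ ℤ.∣ a ∣
∣toℚ∣ a = toℚᵘ-injective (begin
  toℚᵘ ∣ toℚ a ∣          ≈⟨ toℚᵘ-homo-∣-∣ (toℚ a) ⟩
  ℚᵘ.∣ toℚᵘ (toℚ a) ∣     ≈⟨ ℚᵘₚ.∣-∣-cong (toℚᵘ-toℚ a) ⟩
  fromℤᵘ (+ ℤ.∣ a ∣)      ≈⟨ toℚᵘ-toℚ (+ ℤ.∣ a ∣) ⟨
  toℚᵘ (ℕtoℚ ℤ.∣ a ∣)     ∎)
  where open ℚᵘₚ.≃-Reasoning

toℚ-mono-≤ : ∀ {a b} → a ℤ.≤ b → toℚ a ≤ toℚ b
toℚ-mono-≤ {a} {b} a≤b = toℚᵘ-cancel-≤ (ℚᵘₚ.≤-respʳ-≃ (ℚᵘₚ.≃-sym (toℚᵘ-toℚ b))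
  (ℚᵘₚ.≤-respˡ-≃ (ℚᵘₚ.≃-sym (toℚᵘ-toℚ a)) (ℚᵘ.*≤* (ℤₚ.*-monoʳ-≤-nonNeg (+ 1) a≤b))))

toℚ-cancel-< : ∀ {a b} → toℚ a < toℚ b → a ℤ.< b
toℚ-cancel-< {a} {b} lt
  with ℚᵘ.*<* p ← ℚᵘₚ.<-respʳ-≃ (toℚᵘ-toℚ b) (ℚᵘₚ.<-respˡ-≃ (toℚᵘ-toℚ a) (toℚᵘ-mono-< lt))
  = ℤₚ.*-cancelʳ-<-nonNeg (+ 1) p

ℕtoℚ-nonNeg : ∀ k → 0ℚ ≤ ℕtoℚ k
ℕtoℚ-nonNeg k = toℚ-mono-≤ {+ 0} {+ k} (ℤ.+≤+ ℕ.z≤n)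

0<1 : 0ℚ < 1ℚ
0<1 = ℚ.*<* (ℤ.+<+ (ℕ.s≤s ℕ.z≤n))

IsSign : ℤ → Set
IsSign v = v ≡ + 1 ⊎ v ≡ -[1+ 0 ]

sgn-sound : ∀ {v} z → IsSign v → v ≡ sgn z → + 1 ℤ.≤ v ℤ.* z
sgn-sound (+ suc k)  (inj₁ refl) refl = ℤ.+≤+ (ℕ.s≤s ℕ.z≤n)
sgn-sound -[1+ k ]   (inj₂ refl) refl = ℤ.+≤+ (ℕ.s≤s ℕ.z≤n)
sgn-sound (+ zero)   (inj₁ refl) ()
sgn-sound (+ zero)   (inj₂ refl) ()
sgn-sound (+ suc k)  (inj₂ refl) ()
sgn-sound -[1+ k ]   (inj₁ refl) ()

sgn-complete : ∀ {v} z → IsSign v → + 0 ℤ.< v ℤ.* z → v ≡ sgn z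
sgn-complete (+ suc k)  (inj₁ refl) _ = refl
sgn-complete -[1+ k ]   (inj₂ refl) _ = refl
sgn-complete (+ zero)   (inj₁ refl) (ℤ.+<+ ())
sgn-complete (+ zero)   (inj₂ refl) (ℤ.+<+ ())
sgn-complete (+ suc k)  (inj₂ refl) ()
sgn-complete -[1+ k ]   (inj₁ refl) ()

∣toℚ-sign∣ : ∀ {v} → IsSign v → ∣ toℚ v ∣ ≡ 1ℚ
∣toℚ-sign∣ (inj₁ refl) = refl
∣toℚ-sign∣ (inj₂ refl) = refl

∣sign*p∣≡∣p∣ : ∀ {v} → IsSign v → ∀ p → ∣ toℚ v * p ∣ ≡ ∣ p ∣
∣sign*p∣≡∣p∣ {v} sv p = trans (∣p*q∣≡∣p∣*∣q∣ (toℚ v) p) (trans (cong (_* ∣ p ∣) (∣toℚ-sign∣ sv)) (*-identityˡ _))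

∣sign-u∣≡∣1-sign*u∣ : ∀ {v} → IsSign v → ∀ u → ∣ toℚ v - u ∣ ≡ ∣ 1ℚ - toℚ v * u ∣
∣sign-u∣≡∣1-sign*u∣ (inj₁ refl) u = cong (λ w → ∣ 1ℚ - w ∣) (sym (*-identityˡ u))
∣sign-u∣≡∣1-sign*u∣ (inj₂ refl) u = trans (sym (∣-p∣≡∣p∣ _)) (cong ∣_∣ (neg-flip u))
  where
  neg-flip : ∀ u → - (- 1ℚ - u) ≡ 1ℚ - (- 1ℚ) * u
  neg-flip = solve-∀ ℚ-ring

-- Inequalities and rounding in ℚ

p≤∣p∣ : ∀ p → p ≤ ∣ p ∣
p≤∣p∣ p with ≤-total 0ℚ p
... | inj₁ 0≤p = ≤-reflexive (sym (0≤p⇒∣p∣≡p 0≤p))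
... | inj₂ p≤0 = ≤-trans p≤0 (0≤∣p∣ p)

∣p∣*∣p∣≡p*p : ∀ p → ∣ p ∣ * ∣ p ∣ ≡ p * p
∣p∣*∣p∣≡p*p p with ∣p∣≡p∨∣p∣≡-p p
... | inj₁ eq = cong (λ a → a * a) eq
... | inj₂ eq = trans (cong (λ a → a * a) eq) (neg*neg p)
  where
  neg*neg : ∀ p → - p * - p ≡ p * p
  neg*neg = solve-∀ ℚ-ring

*-mono-≤-nonNeg : ∀ {p q r s} → 0ℚ ≤ p → 0ℚ ≤ r → p ≤ q → r ≤ s → p * r ≤ q * s
*-mono-≤-nonNeg {p} {q} {r} {s} 0≤p 0≤r p≤q r≤s = begin
  p * r  ≤⟨ *-monoʳ-≤-nonNeg r {{nonNegative 0≤r}} p≤q ⟩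
  q * r  ≤⟨ *-monoˡ-≤-nonNeg q {{nonNegative (≤-trans 0≤p p≤q)}} r≤s ⟩
  q * s  ∎
  where open ≤-Reasoning

0≤p*p : ∀ p → 0ℚ ≤ p * p
0≤p*p p = subst (0ℚ ≤_) (∣p∣*∣p∣≡p*p p) (*-mono-≤-nonNeg ≤-refl ≤-refl (0≤∣p∣ p) (0≤∣p∣ p))

p≤q⇒0≤q-p : ∀ {p q} → p ≤ q → 0ℚ ≤ q - p
p≤q⇒0≤q-p {p} {q} p≤q = subst (_≤ q - p) (+-inverseʳ p) (+-monoˡ-≤ (- p) p≤q)

q<p+r⇒q-p<r : ∀ {p q r} → q < p + r → q - p < r
q<p+r⇒q-p<r {p} {q} {r} lt = subst (q - p <_) (cancel p r) (+-monoˡ-< (- p) lt)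
  where
  cancel : ∀ p r → p + r - p ≡ r
  cancel = solve-∀ ℚ-ring

p≤q-r⇒r≤q-p : ∀ {p q r} → p ≤ q - r → r ≤ q - p
p≤q-r⇒r≤q-p {p} {q} {r} le = subst (_≤ q - p) (cancel q r) (+-monoʳ-≤ q (neg-antimono-≤ le))
  where
  cancel : ∀ q r → q - (q - r) ≡ r
  cancel = solve-∀ ℚ-ring

q-r≤p⇒q-p≤r : ∀ {p q r} → q - r ≤ p → q - p ≤ r
q-r≤p⇒q-p≤r {p} {q} {r} le = subst (q - p ≤_) (cancel q r) (+-monoʳ-≤ q (neg-antimono-≤ le))
  where
  cancel : ∀ q r → q - (q - r) ≡ r
  cancel = solve-∀ ℚ-ring

∣1-t*q∣≤1-q : ∀ {t q} → 0ℚ ≤ q → 1ℚ ≤ t → t * q ≤ 1ℚ → ∣ 1ℚ - t * q ∣ ≤ 1ℚ - q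
∣1-t*q∣≤1-q {t} {q} 0≤q 1≤t tq≤1 = begin
  ∣ 1ℚ - t * q ∣  ≡⟨ 0≤p⇒∣p∣≡p (p≤q⇒0≤q-p tq≤1) ⟩
  1ℚ - t * q      ≤⟨ +-monoʳ-≤ 1ℚ (neg-antimono-≤ q≤tq) ⟩
  1ℚ - q          ∎
  where
  open ≤-Reasoning
  q≤tq : q ≤ t * q
  q≤tq = subst (_≤ t * q) (*-identityˡ q) (*-monoʳ-≤-nonNeg q {{nonNegative 0≤q}} 1≤t)

c≤a∧∣b∣<c⇒0<a+b : ∀ {a b c} → c ≤ a → ∣ b ∣ < c → 0ℚ < a + b
c≤a∧∣b∣<c⇒0<a+b {a} {b} c≤a ∣b∣<c = subst (_< a + b) (+-inverseˡ b)
  (+-monoˡ-< b (≤-<-trans (≤-trans (p≤∣p∣ (- b)) (≤-reflexive (∣-p∣≡∣p∣ b))) (<-≤-trans ∣b∣<c c≤a)))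

truncation-of-bracket : ∀ {t q} → 0ℚ ≤ t → t ≤ q → q < t + 1ℚ → ∣ t ∣ ≤ ∣ q ∣ × ∣ t - q ∣ < 1ℚ
truncation-of-bracket {t} {q} 0≤t t≤q q<t+1 = ∣t∣≤∣q∣ , ∣t-q∣<1
  where
  open ≤-Reasoning
  ∣t∣≤∣q∣ : ∣ t ∣ ≤ ∣ q ∣
  ∣t∣≤∣q∣ = subst₂ _≤_ (sym (0≤p⇒∣p∣≡p 0≤t)) (sym (0≤p⇒∣p∣≡p (≤-trans 0≤t t≤q))) t≤q
  neg-sub : ∀ t q → - (t - q) ≡ q - t
  neg-sub = solve-∀ ℚ-ring
  ∣t-q∣<1 : ∣ t - q ∣ < 1ℚ
  ∣t-q∣<1 = begin-strict
    ∣ t - q ∣      ≡⟨ ∣-p∣≡∣p∣ (t - q) ⟨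
    ∣ - (t - q) ∣  ≡⟨ cong ∣_∣ (neg-sub t q) ⟩
    ∣ q - t ∣      ≡⟨ 0≤p⇒∣p∣≡p (p≤q⇒0≤q-p t≤q) ⟩
    q - t          <⟨ q<p+r⇒q-p<r q<t+1 ⟩
    1ℚ             ∎

floor-bracket : ∀ n d .(c : Coprime (ℤ.∣ n ∣) (suc d)) →
  toℚ (n /ℕ suc d) ≤ mkℚ n d c × mkℚ n d c < toℚ (n /ℕ suc d) + 1ℚ
floor-bracket n d c =
  toℚᵘ-cancel-≤ (ℚᵘₚ.≤-respˡ-≃ (ℚᵘₚ.≃-sym (toℚᵘ-toℚ z))
    (ℚᵘ.*≤* (subst (z ℤ.* + suc d ℤ.≤_) (sym (ℤₚ.*-identityʳ n)) ([n/ℕd]*d≤n n (suc d))))) ,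
  subst (mkℚ n d c <_) (trans (toℚ-+ (+ 1) z) (+-comm 1ℚ (toℚ z)))
    (toℚᵘ-cancel-< (ℚᵘₚ.<-respʳ-≃ (ℚᵘₚ.≃-sym (toℚᵘ-toℚ (ℤ.suc z)))
      (ℚᵘ.*<* (subst (ℤ._< ℤ.suc z ℤ.* + suc d) (sym (ℤₚ.*-identityʳ n)) (n<s[n/ℕd]*d n (suc d))))))
  where
  z : ℤ
  z = n /ℕ suc d

truncate-nonNeg : ∀ q → 0ℚ ≤ q → ∃ λ z → ∣ toℚ z ∣ ≤ ∣ q ∣ × ∣ toℚ z - q ∣ < 1ℚ
truncate-nonNeg (mkℚ n@(+ _) d c) _ with floor-bracket n d c
... | z≤q , q<z+1 = n /ℕ suc d ,
  truncation-of-bracket (toℚ-mono-≤ (0≤n⇒0≤n/ℕd n (suc d) (ℤ.+≤+ ℕ.z≤n))) z≤q q<z+1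
truncate-nonNeg (mkℚ -[1+ _ ] _ _) (ℚ.*≤* ())

truncate-toward-zero : ∀ q → ∃ λ z → ∣ toℚ z ∣ ≤ ∣ q ∣ × ∣ toℚ z - q ∣ < 1ℚ
truncate-toward-zero q with ≤-total 0ℚ q
... | inj₁ 0≤q = truncate-nonNeg q 0≤q
... | inj₂ q≤0 with truncate-nonNeg (- q) (neg-antimono-≤ q≤0)
...   | z , ∣z∣≤∣-q∣ , ∣z+q∣<1 = ℤ.- z ,
  subst₂ _≤_ (trans (sym (∣-p∣≡∣p∣ (toℚ z))) (cong ∣_∣ (sym (toℚ-neg z)))) (∣-p∣≡∣p∣ q) ∣z∣≤∣-q∣ ,
  subst (_< 1ℚ) (trans (sym (∣-p∣≡∣p∣ _)) (cong ∣_∣ (trans (neg-sub-neg (toℚ z) q) (cong (_- q) (sym (toℚ-neg z)))))) ∣z+q∣<1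
  where
  neg-sub-neg : ∀ t q → - (t - - q) ≡ - t - q
  neg-sub-neg = solve-∀ ℚ-ring

-- Finite sums

∑ : {A : Set} → List A → (A → ℚ) → ℚ
∑ xs h = sumℚ (map h xs)

module _ {A : Set} where

  ∑-cong : ∀ (xs : List A) {h k} → (∀ x → h x ≡ k x) → ∑ xs h ≡ ∑ xs k
  ∑-cong []       eq = refl
  ∑-cong (x ∷ xs) eq = cong₂ _+_ (eq x) (∑-cong xs eq)

  ∑-++ : ∀ (xs ys : List A) h → ∑ (xs ++ ys) h ≡ ∑ xs h + ∑ ys h
  ∑-++ []       ys h = sym (+-identityˡ _)
  ∑-++ (x ∷ xs) ys h = trans (cong (_+_ (h x)) (∑-++ xs ys h)) (sym (+-assoc (h x) _ _))

  ∑-map : ∀ {B : Set} (xs : List B) (g : B → A) h → ∑ (map g xs) h ≡ ∑ xs (h ∘ g)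
  ∑-map []       g h = refl
  ∑-map (x ∷ xs) g h = cong (_+_ (h (g x))) (∑-map xs g h)

  ∑-+ : ∀ (xs : List A) h k → ∑ xs (λ x → h x + k x) ≡ ∑ xs h + ∑ xs k
  ∑-+ []       h k = refl
  ∑-+ (x ∷ xs) h k = trans (cong (_+_ (h x + k x)) (∑-+ xs h k)) (interchange (h x) (k x) (∑ xs h) (∑ xs k))
    where
    interchange : ∀ a b c d → a + b + (c + d) ≡ a + c + (b + d)
    interchange = solve-∀ ℚ-ring

  ∑-*ˡ : ∀ (xs : List A) c h → ∑ xs (λ x → c * h x) ≡ c * ∑ xs h
  ∑-*ˡ []       c h = sym (*-zeroʳ c)
  ∑-*ˡ (x ∷ xs) c h = trans (cong (_+_ (c * h x)) (∑-*ˡ xs c h)) (sym (*-distribˡ-+ c (h x) _))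

  ∑-const : ∀ (xs : List A) c → ∑ xs (λ _ → c) ≡ ℕtoℚ (length xs) * c
  ∑-const []       c = sym (*-zeroˡ c)
  ∑-const (x ∷ xs) c = begin
    c + ∑ xs (λ _ → c)                    ≡⟨ cong (_+_ (c)) (∑-const xs c) ⟩
    c + ℕtoℚ (length xs) * c              ≡⟨ succ c (ℕtoℚ (length xs)) ⟩
    (1ℚ + ℕtoℚ (length xs)) * c           ≡⟨ cong (_* c) (toℚ-+ (+ 1) (+ length xs)) ⟨
    ℕtoℚ (suc (length xs)) * c            ∎
    where
    open ≡-Reasoning
    succ : ∀ c l → c + l * c ≡ (1ℚ + l) * c
    succ = solve-∀ ℚ-ring

  ∑-mono-≤ : ∀ (xs : List A) {h k} → (∀ x → h x ≤ k x) → ∑ xs h ≤ ∑ xs k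
  ∑-mono-≤ []       le = ≤-refl
  ∑-mono-≤ (x ∷ xs) le = +-mono-≤ (le x) (∑-mono-≤ xs le)

  ∑-mono-< : ∀ (xs : List A) {h k} → 1 ≤ℕ length xs → (∀ x → h x < k x) → ∑ xs h < ∑ xs k
  ∑-mono-< (x ∷ xs) _ lt = +-mono-<-≤ (lt x) (∑-mono-≤ xs (λ y → <⇒≤ (lt y)))

  ∑-nonNeg : ∀ (xs : List A) {h} → (∀ x → 0ℚ ≤ h x) → 0ℚ ≤ ∑ xs h
  ∑-nonNeg []       nn = ≤-refl
  ∑-nonNeg (x ∷ xs) nn = +-mono-≤ (nn x) (∑-nonNeg xs nn)

  ∣∑∣≤∑∣∣ : ∀ (xs : List A) h → ∣ ∑ xs h ∣ ≤ ∑ xs (λ x → ∣ h x ∣)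
  ∣∑∣≤∑∣∣ []       h = ≤-refl
  ∣∑∣≤∑∣∣ (x ∷ xs) h = ≤-trans (∣p+q∣≤∣p∣+∣q∣ (h x) _) (+-monoʳ-≤ ∣ h x ∣ (∣∑∣≤∑∣∣ xs h))

  ∑-filter : ∀ {P : Pred A 0ℓ} (P? : Decidable P) (xs : List A) h →
    ∑ (filter P? xs) h ≡ ∑ xs (λ x → if does (P? x) then h x else 0ℚ)
  ∑-filter P? []       h = refl
  ∑-filter P? (x ∷ xs) h with does (P? x)
  ... | true  = cong (_+_ (h x)) (∑-filter P? xs h)
  ... | false = trans (∑-filter P? xs h) (sym (+-identityˡ _))

  toℚ-sumℤ : ∀ (xs : List A) h → toℚ (sumℤ (map h xs)) ≡ ∑ xs (toℚ ∘ h)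
  toℚ-sumℤ []       h = refl
  toℚ-sumℤ (x ∷ xs) h = trans (toℚ-+ (h x) _) (cong (_+_ (toℚ (h x))) (toℚ-sumℤ xs h))

  ℕtoℚ-sumℕ : ∀ (xs : List A) h → ℕtoℚ (sumℕ (map h xs)) ≡ ∑ xs (ℕtoℚ ∘ h)
  ℕtoℚ-sumℕ []       h = refl
  ℕtoℚ-sumℕ (x ∷ xs) h = trans (toℚ-+ (+ h x) (+ sumℕ (map h xs))) (cong (_+_ (ℕtoℚ (h x))) (ℕtoℚ-sumℕ xs h))

  -- Adding a = u y to the list needs 2 a Σu ≤ m a² + Σu², which is Σ (a - u)² ≥ 0.
  cauchy-schwarz : ∀ (xs : List A) u → ∑ xs u * ∑ xs u ≤ ℕtoℚ (length xs) * ∑ xs (λ x → u x * u x)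
  cauchy-schwarz []       u = ≤-refl
  cauchy-schwarz (y ∷ ys) u = begin
    (a + s) * (a + s)              ≡⟨ expand a s ⟩
    a * a + two * a * s + s * s    ≤⟨ +-mono-≤ (+-monoʳ-≤ (a * a) cross) (cauchy-schwarz ys u) ⟩
    a * a + (m * (a * a) + q) + m * q  ≡⟨ collect a m q ⟩
    (1ℚ + m) * (a * a + q)         ≡⟨ cong (_* (a * a + q)) (toℚ-+ (+ 1) (+ length ys)) ⟨
    ℕtoℚ (length (y ∷ ys)) * (a * a + q) ∎
    where
    open ≤-Reasoning
    two a s q m : ℚ
    two = 1ℚ + 1ℚ
    a = u y
    s = ∑ ys u
    q = ∑ ys (λ x → u x * u x)
    m = ℕtoℚ (length ys)
    expand : ∀ a s → (a + s) * (a + s) ≡ a * a + (1ℚ + 1ℚ) * a * s + s * s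
    expand = solve-∀ ℚ-ring
    collect : ∀ a m q → a * a + (m * (a * a) + q) + m * q ≡ (1ℚ + m) * (a * a + q)
    collect = solve-∀ ℚ-ring
    square-split : ∀ a b → (a - b) * (a - b) + two * a * b ≡ a * a + b * b
    square-split = solve-∀ ℚ-ring
    cross : two * a * s ≤ m * (a * a) + q
    cross = begin
      two * a * s                                     ≡⟨ ∑-*ˡ ys (two * a) u ⟨
      ∑ ys (λ x → two * a * u x)                       ≡⟨ +-identityˡ _ ⟨
      0ℚ + ∑ ys (λ x → two * a * u x)                  ≤⟨ +-monoˡ-≤ _ (∑-nonNeg ys (λ x → 0≤p*p (a - u x))) ⟩
      ∑ ys (λ x → (a - u x) * (a - u x)) + ∑ ys (λ x → two * a * u x)   ≡⟨ ∑-+ ys _ _ ⟨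
      ∑ ys (λ x → (a - u x) * (a - u x) + two * a * u x)              ≡⟨ ∑-cong ys (λ x → square-split a (u x)) ⟩
      ∑ ys (λ x → a * a + u x * u x)                   ≡⟨ ∑-+ ys _ _ ⟩
      ∑ ys (λ _ → a * a) + q                           ≡⟨ cong (_+ q) (∑-const ys (a * a)) ⟩
      m * (a * a) + q                                  ∎

-- Polynomials on the cube

∈-cube : ∀ {n} (x : Vec Bool n) → x ∈ cube n
∈-cube []          = here refl
∈-cube (true ∷ x)  = ∈-++⁺ˡ (∈-map⁺ (true ∷_) (∈-cube x))
∈-cube (false ∷ x) = ∈-++⁺ʳ (map (true ∷_) (cube _)) (∈-map⁺ (false ∷_) (∈-cube x))

∑-cube-suc : ∀ n h → ∑ (cube (suc n)) h ≡ ∑ (cube n) (h ∘ (true ∷_)) + ∑ (cube n) (h ∘ (false ∷_))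
∑-cube-suc n h = trans (∑-++ (map (true ∷_) (cube n)) _ h)
  (cong₂ _+_ (∑-map (cube n) (true ∷_) h) (∑-map (cube n) (false ∷_) h))

length-cube-suc : ∀ n → ℕtoℚ (length (cube (suc n))) ≡ ℕtoℚ (length (cube n)) + ℕtoℚ (length (cube n))
length-cube-suc n = begin
  ℕtoℚ (length (map (true ∷_) (cube n) ++ map (false ∷_) (cube n)))
    ≡⟨ cong ℕtoℚ (length-++ (map (true ∷_) (cube n))) ⟩
  ℕtoℚ (length (map (true ∷_) (cube n)) ℕ.+ length (map (false ∷_) (cube n)))
    ≡⟨ cong₂ (λ a b → ℕtoℚ (a ℕ.+ b)) (length-map (true ∷_) (cube n)) (length-map (false ∷_) (cube n)) ⟩
  ℕtoℚ (length (cube n) ℕ.+ length (cube n))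
    ≡⟨ toℚ-+ (+ length (cube n)) (+ length (cube n)) ⟩
  ℕtoℚ (length (cube n)) + ℕtoℚ (length (cube n)) ∎
  where open ≡-Reasoning

length-cube-pos : ∀ n → 0ℚ < ℕtoℚ (length (cube n))
length-cube-pos zero    = 0<1
length-cube-pos (suc n) = subst (0ℚ <_) (sym (length-cube-suc n)) (+-mono-< (length-cube-pos n) (length-cube-pos n))

module _ {A : Set} (h : A → ℚ) where

  ≤-foldr-⊔ : ∀ {x xs} z → x ∈ xs → h x ≤ foldr _⊔_ z (map h xs)
  ≤-foldr-⊔ {x} {y ∷ ys} z (here refl) = p≤p⊔q (h x) _
  ≤-foldr-⊔ {x} {y ∷ ys} z (there x∈ys) = p≤q⇒p≤r⊔q (h y) (≤-foldr-⊔ z x∈ys)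

  foldr-⊔-lub : ∀ xs {b} → 0ℚ ≤ b → (∀ x → h x ≤ b) → foldr _⊔_ 0ℚ (map h xs) ≤ b
  foldr-⊔-lub []       0≤b le = 0≤b
  foldr-⊔-lub (x ∷ xs) 0≤b le = ⊔-lub (le x) (foldr-⊔-lub xs 0≤b le)

module _ {n d : ℕ} (f : Vec Bool n → ℤ) (c : Subset n → ℚ) where

  ≤-approxErr : ∀ x → ∣ toℚ (f x) - evalPoly n d c x ∣ ≤ approxErr n d f c
  ≤-approxErr x = ≤-foldr-⊔ (λ y → ∣ toℚ (f y) - evalPoly n d c y ∣) 0ℚ (∈-cube x)

  approxErr-≤ : ∀ {b} → 0ℚ ≤ b → (∀ x → ∣ toℚ (f x) - evalPoly n d c x ∣ ≤ b) → approxErr n d f c ≤ b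
  approxErr-≤ = foldr-⊔-lub _ (cube n)

-- A basis function ∏_{i ∈ S} φ(x_i): φ = bit gives the monomials, φ = sign the characters.
basis : ∀ {n} → (Bool → ℚ) → Subset n → Vec Bool n → ℚ
basis φ []          []      = 1ℚ
basis φ (true ∷ S)  (b ∷ x) = φ b * basis φ S x
basis φ (false ∷ S) (b ∷ x) = basis φ S x

bit sign : Bool → ℚ
bit  b = if b then 1ℚ else 0ℚ
sign b = if b then - 1ℚ else 1ℚ

monomial≡basis-bit : ∀ {n} (S : Subset n) x → monomial S x ≡ basis bit S x
monomial≡basis-bit []          []      = refl
monomial≡basis-bit (true ∷ S)  (b ∷ x) = cong (bit b *_) (monomial≡basis-bit S x)
monomial≡basis-bit (false ∷ S) (b ∷ x) = trans (*-identityˡ _) (monomial≡basis-bit S x)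

toℚ-χ : ∀ {n} (S : Subset n) x → toℚ (χ S x) ≡ basis sign S x
toℚ-χ []          []          = refl
toℚ-χ (true ∷ S)  (true ∷ x)  = trans (toℚ-* -[1+ 0 ] (χ S x)) (cong (- 1ℚ *_) (toℚ-χ S x))
toℚ-χ (true ∷ S)  (false ∷ x) = trans (toℚ-* (+ 1) (χ S x)) (cong (1ℚ *_) (toℚ-χ S x))
toℚ-χ (false ∷ S) (b ∷ x)     = trans (toℚ-* (+ 1) (χ S x)) (trans (*-identityˡ _) (toℚ-χ S x))

∣basis-sign∣ : ∀ {n} (S : Subset n) x → ∣ basis sign S x ∣ ≡ 1ℚ
∣basis-sign∣ []          []          = refl
∣basis-sign∣ (true ∷ S)  (true ∷ x)  = trans (∣p*q∣≡∣p∣*∣q∣ (- 1ℚ) (basis sign S x)) (cong (1ℚ *_) (∣basis-sign∣ S x))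
∣basis-sign∣ (true ∷ S)  (false ∷ x) = trans (∣p*q∣≡∣p∣*∣q∣ 1ℚ (basis sign S x)) (cong (1ℚ *_) (∣basis-sign∣ S x))
∣basis-sign∣ (false ∷ S) (b ∷ x)     = ∣basis-sign∣ S x

poly : ∀ {n} → (Bool → ℚ) → (Subset n → ℚ) → Vec Bool n → ℚ
poly {n} φ g x = ∑ (cube n) (λ S → g S * basis φ S x)

module _ {n : ℕ} (φ : Bool → ℚ) where

  poly-cong : ∀ {g h : Subset n → ℚ} → (∀ S → g S ≡ h S) → ∀ x → poly φ g x ≡ poly φ h x
  poly-cong eq x = ∑-cong (cube n) (λ S → cong (_* basis φ S x) (eq S))

  poly-+ : ∀ g h x → poly φ (λ S → g S + h S) x ≡ poly φ g x + poly φ h x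
  poly-+ g h x = trans (∑-cong (cube n) (λ S → *-distribʳ-+ (basis φ S x) (g S) (h S))) (∑-+ (cube n) _ _)

  poly-* : ∀ k g x → poly φ (λ S → k * g S) x ≡ k * poly φ g x
  poly-* k g x = trans (∑-cong (cube n) (λ S → *-assoc k (g S) (basis φ S x))) (∑-*ˡ (cube n) k _)

poly-suc : ∀ {n} φ (g : Subset (suc n) → ℚ) b x →
  poly φ g (b ∷ x) ≡ φ b * poly φ (g ∘ (true ∷_)) x + poly φ (g ∘ (false ∷_)) x
poly-suc {n} φ g b x = trans (∑-cube-suc n _) (cong (_+ poly φ (g ∘ (false ∷_)) x)
  (trans (∑-cong (cube n) (λ S → swap (g (true ∷ S)) (φ b) (basis φ S x))) (∑-*ˡ (cube n) (φ b) _)))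
  where
  swap : ∀ a p c → a * (p * c) ≡ p * (a * c)
  swap = solve-∀ ℚ-ring

-- If ψ = u φ + v coordinatewise, then ∏_{i∈S} ψ(x_i) expands over the subsets of S;
-- rebase u v g are the φ-coefficients of the ψ-expansion with coefficients g.
rebase : ℚ → ℚ → ∀ {n} → (Subset n → ℚ) → Subset n → ℚ
rebase u v g []          = g []
rebase u v g (true ∷ S)  = u * rebase u v (g ∘ (true ∷_)) S
rebase u v g (false ∷ S) = rebase u v (g ∘ (false ∷_)) S + v * rebase u v (g ∘ (true ∷_)) S

poly-rebase : ∀ {φ ψ u v} → (∀ b → ψ b ≡ u * φ b + v) →
  ∀ {n} (g : Subset n → ℚ) x → poly φ (rebase u v g) x ≡ poly ψ g x
poly-rebase                 hyp {zero}  g []      = refl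
poly-rebase {φ} {ψ} {u} {v} hyp {suc n} g (b ∷ x) = begin
  poly φ (rebase u v g) (b ∷ x)
    ≡⟨ poly-suc φ (rebase u v g) b x ⟩
  φ b * poly φ (λ S → u * rebase u v gᵗ S) x + poly φ (λ S → rebase u v gᶠ S + v * rebase u v gᵗ S) x
    ≡⟨ cong₂ _+_ (cong (φ b *_) (poly-* φ u (rebase u v gᵗ) x))
               (trans (poly-+ φ (rebase u v gᶠ) _ x) (cong (_+_ (poly φ (rebase u v gᶠ) x)) (poly-* φ v (rebase u v gᵗ) x))) ⟩
  φ b * (u * poly φ (rebase u v gᵗ) x) + (poly φ (rebase u v gᶠ) x + v * poly φ (rebase u v gᵗ) x)
    ≡⟨ cong₂ (λ t f → φ b * (u * t) + (f + v * t)) (poly-rebase hyp gᵗ x) (poly-rebase hyp gᶠ x) ⟩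
  φ b * (u * poly ψ gᵗ x) + (poly ψ gᶠ x + v * poly ψ gᵗ x)
    ≡⟨ regroup (φ b) u v (poly ψ gᵗ x) (poly ψ gᶠ x) ⟩
  (u * φ b + v) * poly ψ gᵗ x + poly ψ gᶠ x
    ≡⟨ cong (λ w → w * poly ψ gᵗ x + poly ψ gᶠ x) (sym (hyp b)) ⟩
  ψ b * poly ψ gᵗ x + poly ψ gᶠ x
    ≡⟨ poly-suc ψ g b x ⟨
  poly ψ g (b ∷ x) ∎
  where
  open ≡-Reasoning
  gᵗ gᶠ : Subset n → ℚ
  gᵗ = g ∘ (true ∷_)
  gᶠ = g ∘ (false ∷_)
  regroup : ∀ p u v t f → p * (u * t) + (f + v * t) ≡ (u * p + v) * t + f
  regroup = solve-∀ ℚ-ring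

½ : ℚ
½ = + 1 ℚ./ 2

-- bit b = ½ - ½ sign b  and  sign b = 1 - 2 bit b
toFourier fromFourier : ∀ {n} → (Subset n → ℚ) → Subset n → ℚ
toFourier   = rebase (- ½) ½
fromFourier = rebase (- (1ℚ + 1ℚ)) 1ℚ

poly-toFourier : ∀ {n} (g : Subset n → ℚ) x → poly sign (toFourier g) x ≡ poly bit g x
poly-toFourier = poly-rebase λ { true → refl ; false → refl }

poly-fromFourier : ∀ {n} (a : Subset n → ℚ) x → poly bit (fromFourier a) x ≡ poly sign a x
poly-fromFourier = poly-rebase λ { true → refl ; false → refl }

DegreeBelow : ∀ {n} → ℕ → (Subset n → ℚ) → Set
DegreeBelow m g = ∀ S → m ≤ℕ ∣ S ∣ˢ → g S ≡ 0ℚ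

degreeBelow-pred : ∀ m {n} (g : Subset (suc n) → ℚ) → DegreeBelow m g → DegreeBelow (ℕ.pred m) (g ∘ (true ∷_))
degreeBelow-pred zero    g deg T _ = deg (true ∷ T) ℕ.z≤n
degreeBelow-pred (suc m) g deg T m≤∣T∣ = deg (true ∷ T) (ℕ.s≤s m≤∣T∣)

rebase-degree : ∀ u v m {n} (g : Subset n → ℚ) → DegreeBelow m g → DegreeBelow m (rebase u v g)
rebase-degree u v m g deg [] m≤0 = deg [] m≤0
rebase-degree u v m g deg (true ∷ S) m≤1+∣S∣ = trans
  (cong (u *_) (rebase-degree u v (ℕ.pred m) _ (degreeBelow-pred m g deg) S (ℕₚ.pred-mono-≤ m≤1+∣S∣)))
  (*-zeroʳ u)
rebase-degree u v m g deg (false ∷ S) m≤∣S∣ = trans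
  (cong₂ (λ a b → a + v * b)
    (rebase-degree u v m _ (λ T → deg (false ∷ T)) S m≤∣S∣)
    (rebase-degree u v (ℕ.pred m) _ (degreeBelow-pred m g deg) S (ℕₚ.≤-trans ℕₚ.pred[n]≤n m≤∣S∣)))
  (cong (_+_ 0ℚ) (*-zeroʳ v))

restrict : ∀ {n} → ℕ → (Subset n → ℚ) → Subset n → ℚ
restrict d h S = if does (∣ S ∣ˢ ≤? d) then h S else 0ℚ

module _ {n : ℕ} (d : ℕ) where

  ∑-lowSubsets : ∀ (h : Subset n → ℚ) → ∑ (lowSubsets n d) h ≡ ∑ (cube n) (restrict d h)
  ∑-lowSubsets = ∑-filter (λ S → ∣ S ∣ˢ ≤? d) (cube n)

  restrict-*ʳ : ∀ (h k : Subset n → ℚ) S → restrict d (λ T → h T * k T) S ≡ restrict d h S * k S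
  restrict-*ʳ h k S with does (∣ S ∣ˢ ≤? d)
  ... | true  = refl
  ... | false = sym (*-zeroˡ (k S))

  restrict-degree : ∀ (h : Subset n → ℚ) → DegreeBelow (suc d) (restrict d h)
  restrict-degree h S d<∣S∣ = cong (λ b → if b then h S else 0ℚ) (dec-false (∣ S ∣ˢ ≤? d) (ℕₚ.<⇒≱ d<∣S∣))

  restrict-id : ∀ {h : Subset n → ℚ} → DegreeBelow (suc d) h → ∀ S → restrict d h S ≡ h S
  restrict-id {h} deg S = by-cases (∣ S ∣ˢ ≤? d)
    where
    by-cases : (D : Dec (∣ S ∣ˢ ≤ℕ d)) → (if does D then h S else 0ℚ) ≡ h S
    by-cases (yes _)     = refl
    by-cases (no ∣S∣≰d) = sym (deg S (ℕₚ.≰⇒> ∣S∣≰d))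

  ∑-lowSubsets-basis : ∀ φ (h : Subset n → ℚ) x → ∑ (lowSubsets n d) (λ S → h S * basis φ S x) ≡ poly φ (restrict d h) x
  ∑-lowSubsets-basis φ h x = trans (∑-lowSubsets _) (∑-cong (cube n) (restrict-*ʳ h (λ S → basis φ S x)))

  evalPoly≡poly : ∀ (c : Subset n → ℚ) x → evalPoly n d c x ≡ poly bit (restrict d c) x
  evalPoly≡poly c x = trans (∑-cong (lowSubsets n d) (λ S → cong (c S *_) (monomial≡basis-bit S x)))
                            (∑-lowSubsets-basis bit c x)

  evalPoly-fromFourier : ∀ (a : Subset n → ℚ) x →
    evalPoly n d (fromFourier (restrict d a)) x ≡ ∑ (lowSubsets n d) (λ S → a S * basis sign S x)
  evalPoly-fromFourier a x = begin
    evalPoly n d (fromFourier (restrict d a)) x             ≡⟨ evalPoly≡poly _ x ⟩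
    poly bit (restrict d (fromFourier (restrict d a))) x    ≡⟨ poly-cong bit (restrict-id (rebase-degree _ _ _ _ (restrict-degree a))) x ⟩
    poly bit (fromFourier (restrict d a)) x                 ≡⟨ poly-fromFourier (restrict d a) x ⟩
    poly sign (restrict d a) x                              ≡⟨ ∑-lowSubsets-basis sign a x ⟨
    ∑ (lowSubsets n d) (λ S → a S * basis sign S x)          ∎
    where open ≡-Reasoning

parseval : ∀ {n} (a : Subset n → ℚ) →
  ∑ (cube n) (λ x → poly sign a x * poly sign a x) ≡ ℕtoℚ (length (cube n)) * ∑ (cube n) (λ S → a S * a S)
parseval {zero}  a = square-unit (a [])
  where
  square-unit : ∀ a → (a * 1ℚ + 0ℚ) * (a * 1ℚ + 0ℚ) + 0ℚ ≡ 1ℚ * (a * a + 0ℚ)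
  square-unit = solve-∀ ℚ-ring
parseval {suc n} a = begin
  ∑ (cube (suc n)) (λ x → P x * P x)
    ≡⟨ ∑-cube-suc n _ ⟩
  ∑ (cube n) (λ x → P (true ∷ x) * P (true ∷ x)) + ∑ (cube n) (λ x → P (false ∷ x) * P (false ∷ x))
    ≡⟨ ∑-+ (cube n) _ _ ⟨
  ∑ (cube n) (λ x → P (true ∷ x) * P (true ∷ x) + P (false ∷ x) * P (false ∷ x))
    ≡⟨ ∑-cong (cube n) (λ x → cong₂ (λ t f → t * t + f * f) (poly-suc sign a true x) (poly-suc sign a false x)) ⟩
  ∑ (cube n) (λ x → (- 1ℚ * Pᵗ x + Pᶠ x) * (- 1ℚ * Pᵗ x + Pᶠ x) + (1ℚ * Pᵗ x + Pᶠ x) * (1ℚ * Pᵗ x + Pᶠ x))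
    ≡⟨ ∑-cong (cube n) (λ x → parallelogram (Pᵗ x) (Pᶠ x)) ⟩
  ∑ (cube n) (λ x → (Pᵗ x * Pᵗ x + Pᶠ x * Pᶠ x) + (Pᵗ x * Pᵗ x + Pᶠ x * Pᶠ x))
    ≡⟨ ∑-+ (cube n) _ _ ⟩
  ∑ (cube n) (λ x → Pᵗ x * Pᵗ x + Pᶠ x * Pᶠ x) + ∑ (cube n) (λ x → Pᵗ x * Pᵗ x + Pᶠ x * Pᶠ x)
    ≡⟨ cong (λ s → s + s) (trans (∑-+ (cube n) _ _) (cong₂ _+_ (parseval (a ∘ (true ∷_))) (parseval (a ∘ (false ∷_))))) ⟩
  (N * Aᵗ + N * Aᶠ) + (N * Aᵗ + N * Aᶠ)
    ≡⟨ regroup N Aᵗ Aᶠ ⟩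
  (N + N) * (Aᵗ + Aᶠ)
    ≡⟨ cong₂ _*_ (sym (length-cube-suc n)) (sym (∑-cube-suc n (λ S → a S * a S))) ⟩
  ℕtoℚ (length (cube (suc n))) * ∑ (cube (suc n)) (λ S → a S * a S) ∎
  where
  open ≡-Reasoning
  P : Vec Bool (suc n) → ℚ
  P = poly sign a
  Pᵗ Pᶠ : Vec Bool n → ℚ
  Pᵗ = poly sign (a ∘ (true ∷_))
  Pᶠ = poly sign (a ∘ (false ∷_))
  N Aᵗ Aᶠ : ℚ
  N  = ℕtoℚ (length (cube n))
  Aᵗ = ∑ (cube n) (λ S → a (true ∷ S) * a (true ∷ S))
  Aᶠ = ∑ (cube n) (λ S → a (false ∷ S) * a (false ∷ S))
  parallelogram : ∀ t f → (- 1ℚ * t + f) * (- 1ℚ * t + f) + (1ℚ * t + f) * (1ℚ * t + f) ≡ (t * t + f * f) + (t * t + f * f)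
  parallelogram = solve-∀ ℚ-ring
  regroup : ∀ N a b → (N * a + N * b) + (N * a + N * b) ≡ (N + N) * (a + b)
  regroup = solve-∀ ℚ-ring

-- Counting the subsets of size at most d

module _ {A B : Set} {P : Pred B 0ℓ} (P? : Decidable P) (g : A → B) where

  filter-map : ∀ xs → filter P? (map g xs) ≡ map g (filter (P? ∘ g) xs)
  filter-map []       = refl
  filter-map (x ∷ xs) with does (P? (g x))
  ... | true  = cong (g x ∷_) (filter-map xs)
  ... | false = filter-map xs

module _ {A : Set} {P Q : Pred A 0ℓ} (P? : Decidable P) (Q? : Decidable Q) where

  filter-does-cong : (∀ x → does (P? x) ≡ does (Q? x)) → ∀ xs → filter P? xs ≡ filter Q? xs
  filter-does-cong eq []       = refl
  filter-does-cong eq (x ∷ xs) with does (P? x) | does (Q? x) | eq x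
  ... | true  | true  | refl = cong (x ∷_) (filter-does-cong eq xs)
  ... | false | false | refl = filter-does-cong eq xs

length-lowSubsets-suc : ∀ n d →
  length (lowSubsets (suc n) d) ≡ length (filter (λ S → suc ∣ S ∣ˢ ≤? d) (cube n)) ℕ.+ length (lowSubsets n d)
length-lowSubsets-suc n d = begin
  length (filter P? (map (true ∷_) (cube n) ++ map (false ∷_) (cube n)))
    ≡⟨ cong length (filter-++ P? (map (true ∷_) (cube n)) _) ⟩
  length (filter P? (map (true ∷_) (cube n)) ++ filter P? (map (false ∷_) (cube n)))
    ≡⟨ length-++ (filter P? (map (true ∷_) (cube n))) ⟩
  length (filter P? (map (true ∷_) (cube n))) ℕ.+ length (filter P? (map (false ∷_) (cube n)))
    ≡⟨ cong₂ ℕ._+_ (length-filter-map true) (length-filter-map false) ⟩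
  length (filter (λ S → suc ∣ S ∣ˢ ≤? d) (cube n)) ℕ.+ length (lowSubsets n d) ∎
  where
  open ≡-Reasoning
  P? : (S : Subset (suc n)) → Dec (∣ S ∣ˢ ≤ℕ d)
  P? S = ∣ S ∣ˢ ≤? d
  length-filter-map : ∀ b → length (filter P? (map (b ∷_) (cube n))) ≡ length (filter (P? ∘ (b ∷_)) (cube n))
  length-filter-map b = trans (cong length (filter-map P? (b ∷_) (cube n))) (length-map {A = Subset n} (b ∷_) (filter (P? ∘ (b ∷_)) (cube n)))

filter-suc≤0 : ∀ {A : Set} (k : A → ℕ) xs → filter (λ x → suc (k x) ≤? 0) xs ≡ []
filter-suc≤0 k []       = refl
filter-suc≤0 k (x ∷ xs) = filter-suc≤0 k xs

does-suc≤suc : ∀ k d → does (suc k ≤? suc d) ≡ does (k ≤? d)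
does-suc≤suc zero    d = refl
does-suc≤suc (suc k) d = refl

binomSum-zero : ∀ d → binomSum 0 d ≡ 1
binomSum-zero zero    = refl
binomSum-zero (suc d) = trans (ℕₚ.+-identityʳ _) (binomSum-zero d)

binomSum-pascal : ∀ n d → binomSum (suc n) (suc d) ≡ binomSum n d ℕ.+ binomSum n (suc d)
binomSum-pascal n zero    = cong suc (sym (nCk+nC[k+1]≡[n+1]C[k+1] n 0))
binomSum-pascal n (suc d) = begin
  binomSum (suc n) (suc d) ℕ.+ suc n C suc (suc d)
    ≡⟨ cong₂ ℕ._+_ (binomSum-pascal n d) (sym (nCk+nC[k+1]≡[n+1]C[k+1] n (suc d))) ⟩
  (binomSum n d ℕ.+ binomSum n (suc d)) ℕ.+ (n C suc d ℕ.+ n C suc (suc d))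
    ≡⟨ ℕ+.interchange (binomSum n d) (binomSum n (suc d)) (n C suc d) (n C suc (suc d)) ⟩
  binomSum n (suc d) ℕ.+ binomSum n (suc (suc d)) ∎
  where open ≡-Reasoning

length-lowSubsets : ∀ n d → length (lowSubsets n d) ≡ binomSum n d
length-lowSubsets zero    d       = sym (binomSum-zero d)
length-lowSubsets (suc n) zero    = trans (length-lowSubsets-suc n zero)
  (trans (cong (λ xs → length xs ℕ.+ length (lowSubsets n zero)) (filter-suc≤0 ∣_∣ˢ (cube n))) (length-lowSubsets n zero))
length-lowSubsets (suc n) (suc d) = begin
  length (lowSubsets (suc n) (suc d))
    ≡⟨ length-lowSubsets-suc n (suc d) ⟩
  length (filter (λ S → suc ∣ S ∣ˢ ≤? suc d) (cube n)) ℕ.+ length (lowSubsets n (suc d))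
    ≡⟨ cong (λ xs → length xs ℕ.+ length (lowSubsets n (suc d))) (filter-does-cong _ _ (λ S → does-suc≤suc ∣ S ∣ˢ d) (cube n)) ⟩
  length (lowSubsets n d) ℕ.+ length (lowSubsets n (suc d))
    ≡⟨ cong₂ ℕ._+_ (length-lowSubsets n d) (length-lowSubsets n (suc d)) ⟩
  binomSum n d ℕ.+ binomSum n (suc d)
    ≡⟨ binomSum-pascal n d ⟨
  binomSum (suc n) (suc d) ∎
  where open ≡-Reasoning

1≤binomSum : ∀ n d → 1 ≤ℕ binomSum n d
1≤binomSum n zero    = ℕₚ.≤-refl
1≤binomSum n (suc d) = ℕₚ.≤-trans (1≤binomSum n d) (ℕₚ.m≤m+n _ _)

-- Threshold representations and the two bounds

thresholdSum : ∀ n d → (Subset n → ℤ) → Vec Bool n → ℤ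
thresholdSum n d λ′ x = sumℤ (map (λ S → λ′ S ℤ.* χ S x) (lowSubsets n d))

toℚ-thresholdSum : ∀ {n} d (λ′ : Subset n → ℤ) x →
  toℚ (thresholdSum n d λ′ x) ≡ ∑ (lowSubsets n d) (λ S → toℚ (λ′ S) * basis sign S x)
toℚ-thresholdSum {n} d λ′ x = trans (toℚ-sumℤ (lowSubsets n d) _)
  (∑-cong (lowSubsets n d) (λ S → trans (toℚ-* (λ′ S) (χ S x)) (cong (toℚ (λ′ S) *_) (toℚ-χ S x))))

∣thresholdSum∣≤weight : ∀ {n} d (λ′ : Subset n → ℤ) x → ∣ toℚ (thresholdSum n d λ′ x) ∣ ≤ ℕtoℚ (weight n d λ′)
∣thresholdSum∣≤weight {n} d λ′ x = begin
  ∣ toℚ (thresholdSum n d λ′ x) ∣                          ≡⟨ cong ∣_∣ (toℚ-thresholdSum d λ′ x) ⟩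
  ∣ ∑ (lowSubsets n d) (λ S → toℚ (λ′ S) * basis sign S x) ∣ ≤⟨ ∣∑∣≤∑∣∣ (lowSubsets n d) _ ⟩
  ∑ (lowSubsets n d) (λ S → ∣ toℚ (λ′ S) * basis sign S x ∣) ≡⟨ ∑-cong (lowSubsets n d) ∣term∣ ⟩
  ∑ (lowSubsets n d) (λ S → ℕtoℚ ℤ.∣ λ′ S ∣)                 ≡⟨ ℕtoℚ-sumℕ (lowSubsets n d) _ ⟨
  ℕtoℚ (weight n d λ′)                                     ∎
  where
  open ≤-Reasoning
  ∣term∣ : ∀ S → ∣ toℚ (λ′ S) * basis sign S x ∣ ≡ ℕtoℚ ℤ.∣ λ′ S ∣
  ∣term∣ S = trans (∣p*q∣≡∣p∣*∣q∣ (toℚ (λ′ S)) _)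
    (trans (cong₂ _*_ (∣toℚ∣ (λ′ S)) (∣basis-sign∣ S x)) (*-identityʳ _))

module _ {n d : ℕ} (f : Vec Bool n → ℤ) (f-sign : ∀ x → IsSign (f x))
         (λ′ : Subset n → ℤ) (represents : Represents n d f λ′) where

  private
    W : ℚ
    W = ℕtoℚ (weight n d λ′)

    P : Vec Bool n → ℚ
    P x = toℚ (thresholdSum n d λ′ x)

    1≤fP : ∀ x → 1ℚ ≤ toℚ (f x) * P x
    1≤fP x = subst (1ℚ ≤_) (toℚ-* (f x) _) (toℚ-mono-≤ (sgn-sound _ (f-sign x) (represents x)))

    fP≤W : ∀ x → toℚ (f x) * P x ≤ W
    fP≤W x = ≤-trans (p≤∣p∣ _) (subst (_≤ W) (sym (∣sign*p∣≡∣p∣ (f-sign x) (P x))) (∣thresholdSum∣≤weight d λ′ x))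

    1≤W : 1ℚ ≤ W
    1≤W = ≤-trans (1≤fP (replicate n false)) (fP≤W (replicate n false))

    0<W : 0ℚ < W
    0<W = <-≤-trans 0<1 1≤W

    instance
      W-pos : ℚ.Positive W
      W-pos = positive 0<W
      W-nonZero : ℚ.NonZero W
      W-nonZero = pos⇒nonZero W

    q : ℚ
    q = 1/ W

    0≤q : 0ℚ ≤ q
    0≤q = <⇒≤ (positive⁻¹ q {{1/pos⇒pos W}})

    Wq≡1 : W * q ≡ 1ℚ
    Wq≡1 = *-inverseʳ W

    c : Subset n → ℚ
    c = fromFourier (restrict d (λ S → toℚ (λ′ S) * q))

    evalPoly-c : ∀ x → evalPoly n d c x ≡ P x * q
    evalPoly-c x = begin
      evalPoly n d c x                                                   ≡⟨ evalPoly-fromFourier d _ x ⟩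
      ∑ (lowSubsets n d) (λ S → toℚ (λ′ S) * q * basis sign S x)          ≡⟨ ∑-cong (lowSubsets n d) (λ S → rotate (toℚ (λ′ S)) q (basis sign S x)) ⟩
      ∑ (lowSubsets n d) (λ S → q * (toℚ (λ′ S) * basis sign S x))        ≡⟨ ∑-*ˡ (lowSubsets n d) q _ ⟩
      q * ∑ (lowSubsets n d) (λ S → toℚ (λ′ S) * basis sign S x)          ≡⟨ cong (q *_) (toℚ-thresholdSum d λ′ x) ⟨
      q * P x                                                            ≡⟨ *-comm q (P x) ⟩
      P x * q                                                            ∎
      where
      open ≡-Reasoning
      rotate : ∀ l q b → l * q * b ≡ q * (l * b)
      rotate = solve-∀ ℚ-ring

    approxErr-c : approxErr n d f c ≤ 1ℚ - q
    approxErr-c = approxErr-≤ f c (p≤q⇒0≤q-p q≤1) λ x → begin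
      ∣ toℚ (f x) - evalPoly n d c x ∣      ≡⟨ cong (λ u → ∣ toℚ (f x) - u ∣) (evalPoly-c x) ⟩
      ∣ toℚ (f x) - P x * q ∣               ≡⟨ ∣sign-u∣≡∣1-sign*u∣ (f-sign x) (P x * q) ⟩
      ∣ 1ℚ - toℚ (f x) * (P x * q) ∣        ≡⟨ cong (λ u → ∣ 1ℚ - u ∣) (sym (*-assoc (toℚ (f x)) (P x) q)) ⟩
      ∣ 1ℚ - toℚ (f x) * P x * q ∣          ≤⟨ ∣1-t*q∣≤1-q 0≤q (1≤fP x) (fPq≤1 x) ⟩
      1ℚ - q                               ∎
      where
      open ≤-Reasoning
      fPq≤1 : ∀ x → toℚ (f x) * P x * q ≤ 1ℚ
      fPq≤1 x = subst (toℚ (f x) * P x * q ≤_) Wq≡1 (*-monoʳ-≤-nonNeg q {{nonNegative 0≤q}} (fP≤W x))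
      q≤1 : q ≤ 1ℚ
      q≤1 = subst₂ _≤_ (*-identityˡ q) Wq≡1 (*-monoʳ-≤-nonNeg q {{nonNegative 0≤q}} 1≤W)

  weight-bound-below : ∀ {e} → (∀ c → e ≤ approxErr n d f c) → 1ℚ ≤ ℕtoℚ (weight n d λ′) * (1ℚ - e)
  weight-bound-below {e} optimal = begin
    1ℚ             ≡⟨ Wq≡1 ⟨
    W * q          ≤⟨ *-monoˡ-≤-nonNeg W {{nonNegative (<⇒≤ 0<W)}} (p≤q-r⇒r≤q-p {e} {1ℚ} {q} (≤-trans (optimal c) approxErr-c)) ⟩
    W * (1ℚ - e)   ∎
    where open ≤-Reasoning

module _ {n d : ℕ} (f : Vec Bool n → ℤ) (f-sign : ∀ x → IsSign (f x))
         (c : Subset n → ℚ) {e} (c-error : approxErr n d f c ≡ e) (e<1 : e < 1ℚ) where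

  private
    low : List (Subset n)
    low = lowSubsets n d

    L δ : ℚ
    L = ℕtoℚ (binomSum n d)
    δ = 1ℚ - e

    0<δ : 0ℚ < δ
    0<δ = subst (_< δ) (+-inverseʳ e) (+-monoˡ-< (- e) e<1)

    instance
      δ-pos : ℚ.Positive δ
      δ-pos = positive 0<δ
      δ-nonZero : ℚ.NonZero δ
      δ-nonZero = pos⇒nonZero δ

    p s : Vec Bool n → ℚ
    p = evalPoly n d c
    s x = toℚ (f x)

    ∣1-sp∣≤e : ∀ x → ∣ 1ℚ - s x * p x ∣ ≤ e
    ∣1-sp∣≤e x = subst₂ _≤_ (∣sign-u∣≡∣1-sign*u∣ (f-sign x) (p x)) c-error (≤-approxErr f c x)

    δ≤sp : ∀ x → δ ≤ s x * p x
    δ≤sp x = q-r≤p⇒q-p≤r {e} {1ℚ} {s x * p x} (≤-trans (p≤∣p∣ _) (∣1-sp∣≤e x))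

    p²≤4 : ∀ x → p x * p x ≤ (1ℚ + 1ℚ) * (1ℚ + 1ℚ)
    p²≤4 x = subst (_≤ _) (∣p∣*∣p∣≡p*p (p x)) (*-mono-≤-nonNeg (0≤∣p∣ _) (0≤∣p∣ _) ∣p∣≤2 ∣p∣≤2)
      where
      ∣p∣≤2 : ∣ p x ∣ ≤ 1ℚ + 1ℚ
      ∣p∣≤2 = begin
        ∣ p x ∣                           ≡⟨ ∣sign*p∣≡∣p∣ (f-sign x) (p x) ⟨
        ∣ s x * p x ∣                     ≡⟨ cong ∣_∣ (double-sub 1ℚ (s x * p x)) ⟩
        ∣ 1ℚ - (1ℚ - s x * p x) ∣         ≤⟨ ∣p-q∣≤∣p∣+∣q∣ 1ℚ (1ℚ - s x * p x) ⟩
        1ℚ + ∣ 1ℚ - s x * p x ∣           ≤⟨ +-monoʳ-≤ 1ℚ (≤-trans (∣1-sp∣≤e x) (<⇒≤ e<1)) ⟩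
        1ℚ + 1ℚ                           ∎
        where
        open ≤-Reasoning
        double-sub : ∀ a b → b ≡ a - (a - b)
        double-sub = solve-∀ ℚ-ring

    a : Subset n → ℚ
    a = toFourier (restrict d c)

    a-degree : DegreeBelow (suc d) a
    a-degree = rebase-degree _ _ _ _ (restrict-degree d c)

    p≡poly-a : ∀ x → p x ≡ poly sign a x
    p≡poly-a x = trans (evalPoly≡poly d c x) (sym (poly-toFourier (restrict d c) x))

    p≡∑ : ∀ x → p x ≡ ∑ low (λ S → a S * basis sign S x)
    p≡∑ x = trans (p≡poly-a x) (trans (poly-cong sign (λ S → sym (restrict-id d a-degree S)) x)
                                      (sym (∑-lowSubsets-basis d sign a x)))

    ∑a²≤4 : ∑ low (λ S → a S * a S) ≤ (1ℚ + 1ℚ) * (1ℚ + 1ℚ)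
    ∑a²≤4 = subst (_≤ _) (sym low≡cube) (*-cancelˡ-≤-pos N {{positive (length-cube-pos n)}} (begin
      N * ∑ (cube n) (λ S → a S * a S)          ≡⟨ parseval a ⟨
      ∑ (cube n) (λ x → poly sign a x * poly sign a x)
                                                ≡⟨ ∑-cong (cube n) (λ x → cong (λ u → u * u) (sym (p≡poly-a x))) ⟩
      ∑ (cube n) (λ x → p x * p x)              ≤⟨ ∑-mono-≤ (cube n) p²≤4 ⟩
      ∑ (cube n) (λ _ → (1ℚ + 1ℚ) * (1ℚ + 1ℚ))  ≡⟨ ∑-const (cube n) _ ⟩
      N * ((1ℚ + 1ℚ) * (1ℚ + 1ℚ))               ∎))
      where
      open ≤-Reasoning
      N : ℚ
      N = ℕtoℚ (length (cube n))
      low≡cube : ∑ low (λ S → a S * a S) ≡ ∑ (cube n) (λ S → a S * a S)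
      low≡cube = trans (∑-lowSubsets d (λ S → a S * a S))
        (∑-cong (cube n) (λ S → trans (restrict-*ʳ d a a S) (cong (_* a S) (restrict-id d a-degree S))))

    A : ℚ
    A = ∑ low (λ S → ∣ a S ∣)

    A²≤4L : A * A ≤ L * ((1ℚ + 1ℚ) * (1ℚ + 1ℚ))
    A²≤4L = begin
      A * A                                      ≤⟨ cauchy-schwarz low (λ S → ∣ a S ∣) ⟩
      ℕtoℚ (length low) * ∑ low (λ S → ∣ a S ∣ * ∣ a S ∣)
                                                 ≡⟨ cong₂ (λ l σ → ℕtoℚ l * σ) (length-lowSubsets n d) (∑-cong low (λ S → ∣p∣*∣p∣≡p*p (a S))) ⟩
      L * ∑ low (λ S → a S * a S)                ≤⟨ *-monoˡ-≤-nonNeg L {{nonNegative (ℕtoℚ-nonNeg (binomSum n d))}} ∑a²≤4 ⟩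
      L * ((1ℚ + 1ℚ) * (1ℚ + 1ℚ))                ∎
      where open ≤-Reasoning

    K : ℚ
    K = L * 1/ δ

    Kδ≡L : K * δ ≡ L
    Kδ≡L = trans (*-assoc L (1/ δ) δ) (trans (cong (L *_) (*-inverseˡ δ)) (*-identityʳ L))

    0≤K : 0ℚ ≤ K
    0≤K = *-mono-≤-nonNeg ≤-refl ≤-refl (ℕtoℚ-nonNeg (binomSum n d)) (<⇒≤ (positive⁻¹ (1/ δ) {{1/pos⇒pos δ}}))

  threshold : Subset n → ℤ
  threshold S = proj₁ (truncate-toward-zero (K * a S))

  private
    ∣threshold∣≤ : ∀ S → ∣ toℚ (threshold S) ∣ ≤ ∣ K * a S ∣
    ∣threshold∣≤ S = proj₁ (proj₂ (truncate-toward-zero (K * a S)))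

    rounding-error : ∀ S → ∣ toℚ (threshold S) - K * a S ∣ < 1ℚ
    rounding-error S = proj₂ (proj₂ (truncate-toward-zero (K * a S)))

    r : Vec Bool n → ℚ
    r x = ∑ low (λ S → (toℚ (threshold S) - K * a S) * basis sign S x)

    thresholdSum≡Kp+r : ∀ x → toℚ (thresholdSum n d threshold x) ≡ K * p x + r x
    thresholdSum≡Kp+r x = begin
      toℚ (thresholdSum n d threshold x)
        ≡⟨ toℚ-thresholdSum d threshold x ⟩
      ∑ low (λ S → toℚ (threshold S) * basis sign S x)
        ≡⟨ ∑-cong low (λ S → split K (a S) (toℚ (threshold S)) (basis sign S x)) ⟩
      ∑ low (λ S → K * (a S * basis sign S x) + (toℚ (threshold S) - K * a S) * basis sign S x)
        ≡⟨ ∑-+ low _ _ ⟩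
      ∑ low (λ S → K * (a S * basis sign S x)) + r x
        ≡⟨ cong (_+ r x) (trans (∑-*ˡ low K _) (cong (K *_) (sym (p≡∑ x)))) ⟩
      K * p x + r x ∎
      where
      open ≡-Reasoning
      split : ∀ k a t b → t * b ≡ k * (a * b) + (t - k * a) * b
      split = solve-∀ ℚ-ring

    ∣r∣<L : ∀ x → ∣ r x ∣ < L
    ∣r∣<L x = begin-strict
      ∣ r x ∣                                                  ≤⟨ ∣∑∣≤∑∣∣ low _ ⟩
      ∑ low (λ S → ∣ (toℚ (threshold S) - K * a S) * basis sign S x ∣)
                                                               ≡⟨ ∑-cong low ∣term∣ ⟩
      ∑ low (λ S → ∣ toℚ (threshold S) - K * a S ∣)            <⟨ ∑-mono-< low 1≤length rounding-error ⟩
      ∑ low (λ _ → 1ℚ)                                         ≡⟨ ∑-const low 1ℚ ⟩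
      ℕtoℚ (length low) * 1ℚ                                   ≡⟨ *-identityʳ _ ⟩
      ℕtoℚ (length low)                                        ≡⟨ cong ℕtoℚ (length-lowSubsets n d) ⟩
      L                                                        ∎
      where
      open ≤-Reasoning
      1≤length : 1 ≤ℕ length low
      1≤length = subst (1 ≤ℕ_) (sym (length-lowSubsets n d)) (1≤binomSum n d)
      ∣term∣ : ∀ S → ∣ (toℚ (threshold S) - K * a S) * basis sign S x ∣ ≡ ∣ toℚ (threshold S) - K * a S ∣
      ∣term∣ S = trans (∣p*q∣≡∣p∣*∣q∣ (toℚ (threshold S) - K * a S) (basis sign S x))
        (trans (cong (∣ toℚ (threshold S) - K * a S ∣ *_) (∣basis-sign∣ S x)) (*-identityʳ _))

  threshold-represents : Represents n d f threshold
  threshold-represents x = sgn-complete _ (f-sign x) (toℚ-cancel-< (subst (0ℚ <_) (sym (toℚ-* (f x) _)) 0<fZ))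
    where
    open ≤-Reasoning
    0<fZ : 0ℚ < s x * toℚ (thresholdSum n d threshold x)
    0<fZ = subst (0ℚ <_) (sym (trans (cong (s x *_) (thresholdSum≡Kp+r x)) (distribute (s x) K (p x) (r x))))
      (c≤a∧∣b∣<c⇒0<a+b (begin
        L                 ≡⟨ Kδ≡L ⟨
        K * δ             ≤⟨ *-monoˡ-≤-nonNeg K {{nonNegative 0≤K}} (δ≤sp x) ⟩
        K * (s x * p x)   ∎)
      (subst (_< L) (sym (∣sign*p∣≡∣p∣ (f-sign x) (r x))) (∣r∣<L x)))
      where
      distribute : ∀ s k p r → s * (k * p + r) ≡ k * (s * p) + s * r
      distribute = solve-∀ ℚ-ring

  private
    weight≤KA : ℕtoℚ (weight n d threshold) ≤ K * A
    weight≤KA = begin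
      ℕtoℚ (weight n d threshold)            ≡⟨ ℕtoℚ-sumℕ low _ ⟩
      ∑ low (λ S → ℕtoℚ ℤ.∣ threshold S ∣)   ≡⟨ ∑-cong low (λ S → sym (∣toℚ∣ (threshold S))) ⟩
      ∑ low (λ S → ∣ toℚ (threshold S) ∣)    ≤⟨ ∑-mono-≤ low ∣threshold∣≤ ⟩
      ∑ low (λ S → ∣ K * a S ∣)              ≡⟨ ∑-cong low (λ S → trans (∣p*q∣≡∣p∣*∣q∣ K (a S)) (cong (_* ∣ a S ∣) (0≤p⇒∣p∣≡p 0≤K))) ⟩
      ∑ low (λ S → K * ∣ a S ∣)              ≡⟨ ∑-*ˡ low K _ ⟩
      K * A                                  ∎
      where open ≤-Reasoning

  weight-bound-above : ∀ w → w ≤ℕ weight n d threshold →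
    (ℕtoℚ w * (1ℚ - e)) * (ℕtoℚ w * (1ℚ - e))
      ≤ ℕtoℚ 4 * (ℕtoℚ (binomSum n d) * ℕtoℚ (binomSum n d) * ℕtoℚ (binomSum n d))
  weight-bound-above w w≤weight = begin
    (ℕtoℚ w * δ) * (ℕtoℚ w * δ)   ≤⟨ *-mono-≤-nonNeg 0≤wδ 0≤wδ wδ≤LA wδ≤LA ⟩
    (L * A) * (L * A)             ≡⟨ regroup L A ⟩
    (L * L) * (A * A)             ≤⟨ *-monoˡ-≤-nonNeg (L * L) {{nonNegative (0≤p*p L)}} A²≤4L ⟩
    (L * L) * (L * ((1ℚ + 1ℚ) * (1ℚ + 1ℚ)))  ≡⟨ collect L ⟩
    ℕtoℚ 4 * (L * L * L)          ∎
    where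
    open ≤-Reasoning
    0≤wδ : 0ℚ ≤ ℕtoℚ w * δ
    0≤wδ = *-mono-≤-nonNeg ≤-refl ≤-refl (ℕtoℚ-nonNeg w) (<⇒≤ 0<δ)
    wδ≤LA : ℕtoℚ w * δ ≤ L * A
    wδ≤LA = begin
      ℕtoℚ w * δ                    ≤⟨ *-monoʳ-≤-nonNeg δ {{nonNegative (<⇒≤ 0<δ)}} (≤-trans (toℚ-mono-≤ (ℤ.+≤+ w≤weight)) weight≤KA) ⟩
      K * A * δ                     ≡⟨ swap K A δ ⟩
      K * δ * A                     ≡⟨ cong (_* A) Kδ≡L ⟩
      L * A                         ∎
      where
      swap : ∀ k a d → k * a * d ≡ k * d * a
      swap = solve-∀ ℚ-ring
    regroup : ∀ l a → (l * a) * (l * a) ≡ (l * l) * (a * a)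
    regroup = solve-∀ ℚ-ring
    collect : ∀ l → (l * l) * (l * ((1ℚ + 1ℚ) * (1ℚ + 1ℚ))) ≡ ℕtoℚ 4 * (l * l * l)
    collect = solve-∀ ℚ-ring

best-error≤1 : ∀ {n d} (f : Vec Bool n → ℤ) → (∀ x → IsSign (f x)) →
  ∀ {e} → (∀ c → e ≤ approxErr n d f c) → e ≤ 1ℚ
best-error≤1 {n} {d} f f-sign optimal = ≤-trans (optimal zero-poly) (approxErr-≤ f zero-poly (<⇒≤ 0<1) (λ x → ≤-reflexive (∣f-0∣≡1 x)))
  where
  zero-poly : Subset n → ℚ
  zero-poly _ = 0ℚ
  ∣f-0∣≡1 : ∀ x → ∣ toℚ (f x) - evalPoly n d zero-poly x ∣ ≡ 1ℚ
  ∣f-0∣≡1 x = begin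
    ∣ toℚ (f x) - evalPoly n d zero-poly x ∣   ≡⟨ cong (λ u → ∣ toℚ (f x) - u ∣) evalPoly-zero ⟩
    ∣ toℚ (f x) - 0ℚ ∣                        ≡⟨ cong ∣_∣ (+-identityʳ (toℚ (f x))) ⟩
    ∣ toℚ (f x) ∣                             ≡⟨ ∣toℚ-sign∣ (f-sign x) ⟩
    1ℚ                                        ∎
    where
    open ≡-Reasoning
    evalPoly-zero : evalPoly n d zero-poly x ≡ 0ℚ
    evalPoly-zero = trans (∑-cong (lowSubsets n d) (λ S → *-zeroˡ (monomial S x)))
                          (trans (∑-const (lowSubsets n d) 0ℚ) (*-zeroʳ (ℕtoℚ (length (lowSubsets n d)))))

1≤w*[1-e]⇒e<1 : ∀ w {e} → 1ℚ ≤ ℕtoℚ w * (1ℚ - e) → e < 1ℚ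
1≤w*[1-e]⇒e<1 w {e} 1≤w[1-e] = ≰⇒> λ 1≤e → <-irrefl refl (<-≤-trans 0<1 (begin
  1ℚ                  ≤⟨ 1≤w[1-e] ⟩
  ℕtoℚ w * (1ℚ - e)   ≤⟨ *-monoˡ-≤-nonNeg (ℕtoℚ w) {{nonNegative (ℕtoℚ-nonNeg w)}} (1-e≤0 1≤e) ⟩
  ℕtoℚ w * 0ℚ         ≡⟨ *-zeroʳ (ℕtoℚ w) ⟩
  0ℚ                  ∎))
  where
  open ≤-Reasoning
  1-e≤0 : 1ℚ ≤ e → 1ℚ - e ≤ 0ℚ
  1-e≤0 1≤e = subst (1ℚ - e ≤_) (+-inverseʳ e) (+-monoˡ-≤ (- e) 1≤e)

theorem2p5 : (n : ℕ) (f : Vec Bool n → ℤ) →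
    (∀ x → f x ≡ + 1 ⊎ f x ≡ -[1+ 0 ]) →
    (d : ℕ) → d ≤ℕ n →
    (e : ℚ) → IsE n f d e →
    ((w : ℕ) → IsW n f d w →
        (1ℚ ≤ ℕtoℚ w * (1ℚ - e))
      × ((ℕtoℚ w * (1ℚ - e)) * (ℕtoℚ w * (1ℚ - e))
           ≤ ℕtoℚ 4 * (ℕtoℚ (binomSum n d) * ℕtoℚ (binomSum n d) * ℕtoℚ (binomSum n d))))
    × (WInfinite n f d → e ≡ 1ℚ)
theorem2p5 n f f-sign d _ e ((c , c-error) , optimal) = bounds , infinite⇒e≡1
  where
  bounds : (w : ℕ) → IsW n f d w →
      (1ℚ ≤ ℕtoℚ w * (1ℚ - e))
    × ((ℕtoℚ w * (1ℚ - e)) * (ℕtoℚ w * (1ℚ - e))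
         ≤ ℕtoℚ 4 * (ℕtoℚ (binomSum n d) * ℕtoℚ (binomSum n d) * ℕtoℚ (binomSum n d)))
  bounds w ((λ′ , represents , refl) , minimal) =
    below , weight-bound-above f f-sign c c-error e<1 w (minimal (threshold f f-sign c c-error e<1) (threshold-represents f f-sign c c-error e<1))
    where
    below : 1ℚ ≤ ℕtoℚ w * (1ℚ - e)
    below = weight-bound-below f f-sign λ′ represents optimal
    e<1 : e < 1ℚ
    e<1 = 1≤w*[1-e]⇒e<1 w below
  infinite⇒e≡1 : WInfinite n f d → e ≡ 1ℚ
  infinite⇒e≡1 infinite with e <? 1ℚ
  ... | yes e<1 = ⊥-elim (infinite (threshold f f-sign c c-error e<1) (threshold-represents f f-sign c c-error e<1))
  ... | no  e≮1 = ≤-antisym (best-error≤1 f f-sign optimal) (≮⇒≥ e≮1)
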